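{- The lower block switching class is equal to the lower $\{C_4,\text{diamond}\}$-free switching class.
   Context: All graphs are finite and simple. For a graph $G$ and $A\subseteq V(G)$, the switching $S(G,A)$ is the graph on $V(G)$ whose edges are the edges of $G$ with both ends in $A$, the edges of $G$ with both ends outside $A$, and all pairs $uv$ with $u\in A$, $v\notin A$, $uv\notin E(G)$. For a graph class $\mathcal{G}$, the lower $\mathcal{G}$ switching class is the class of graphs $G$ such that $S(G,A)\in\mathcal{G}$ for every $A\subseteq V(G)$. A block graph is a graph in which every maximal biconnected subgraph is a clique. The diamond is $K_4$ minus one edge; $\{C_4,\text{diamond}\}$-free graphs are those with no induced 4-cycle and no induced diamond. -}

module Defs where

open import Data.Nat using (ℕ)
open import Data.Fin using (Fin; _≟_)
open import Data.Fin.Patterns using (0F; 1F; 2F; 3F)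
open import Data.Bool using (Bool; true; false; not; _∧_; if_then_else_)
open import Data.Product using (Σ; ∃; _×_; _,_)
open import Relation.Nullary using (¬_; ⌊_⌋)
open import Relation.Binary.PropositionalEquality using (_≡_; _≢_; refl; cong)
open import Function.Definitions using (Injective)

record Graph (n : ℕ) : Set where
  field
    adj    : Fin n → Fin n → Bool
    sym    : ∀ u v → adj u v ≡ adj v u
    irrefl : ∀ u → adj u u ≡ false
open Graph public

Adj : ∀ {n} → Graph n → Fin n → Fin n → Set
Adj G u v = adj G u v ≡ true

VSet : ℕ → Set
VSet n = Fin n → Bool

_∈_ : ∀ {n} → Fin n → VSet n → Set
v ∈ S = S v ≡ true

_⊆_ : ∀ {n} → VSet n → VSet n → Set
S ⊆ T = ∀ v → v ∈ S → v ∈ T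

_─_ : ∀ {n} → VSet n → Fin n → VSet n
(S ─ v) w = S w ∧ not ⌊ w ≟ v ⌋

sameSide : Bool → Bool → Bool
sameSide true  true  = true
sameSide false false = true
sameSide _     _     = false

sameSide-sym : ∀ a b → sameSide a b ≡ sameSide b a
sameSide-sym true  true  = refl
sameSide-sym true  false = refl
sameSide-sym false true  = refl
sameSide-sym false false = refl

sameSide-refl : ∀ a → sameSide a a ≡ true
sameSide-refl true  = refl
sameSide-refl false = refl

switchAdj : ∀ {n} → Graph n → VSet n → Fin n → Fin n → Bool
switchAdj G A u v = if sameSide (A u) (A v) then adj G u v else not (adj G u v)

private
  switch-sym : ∀ {n} (G : Graph n) (A : VSet n) u v →
               switchAdj G A u v ≡ switchAdj G A v u
  switch-sym G A u v rewrite sameSide-sym (A u) (A v) | sym G u v = refl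

  switch-irrefl : ∀ {n} (G : Graph n) (A : VSet n) u → switchAdj G A u u ≡ false
  switch-irrefl G A u rewrite sameSide-refl (A u) = irrefl G u

switch : ∀ {n} → Graph n → VSet n → Graph n
switch G A = record
  { adj = switchAdj G A ; sym = switch-sym G A ; irrefl = switch-irrefl G A }

LowerSwitching : (∀ {n} → Graph n → Set) → ∀ {n} → Graph n → Set
LowerSwitching 𝒢 G = ∀ A → 𝒢 (switch G A)

HasInduced : ∀ {k n} → (Fin k → Fin k → Bool) → Graph n → Set
HasInduced {k} {n} H G =
  Σ (Fin k → Fin n) λ f → Injective _≡_ _≡_ f × (∀ i j → adj G (f i) (f j) ≡ H i j)

C4adj : Fin 4 → Fin 4 → Bool
C4adj 0F 1F = true
C4adj 1F 0F = true
C4adj 1F 2F = true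
C4adj 2F 1F = true
C4adj 2F 3F = true
C4adj 3F 2F = true
C4adj 3F 0F = true
C4adj 0F 3F = true
C4adj _  _  = false

diamondAdj : Fin 4 → Fin 4 → Bool
diamondAdj 0F 2F = false
diamondAdj 2F 0F = false
diamondAdj i  j  = not ⌊ i ≟ j ⌋

C4DiamondFree : ∀ {n} → Graph n → Set
C4DiamondFree G = ¬ HasInduced C4adj G × ¬ HasInduced diamondAdj G

data Reach {n} (G : Graph n) (S : VSet n) (u : Fin n) : Fin n → Set where
  here : u ∈ S → Reach G S u u
  step : ∀ {w v} → Reach G S u w → Adj G w v → v ∈ S → Reach G S u v

Connected : ∀ {n} → Graph n → VSet n → Set
Connected G S = ∀ u v → u ∈ S → v ∈ S → Reach G S u v

Biconnected : ∀ {n} → Graph n → VSet n → Set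
Biconnected G S =
  (∃ λ u → ∃ λ v → u ≢ v × u ∈ S × v ∈ S) ×
  Connected G S ×
  (∀ v → v ∈ S → Connected G (S ─ v))

MaximalBiconnected : ∀ {n} → Graph n → VSet n → Set
MaximalBiconnected G S =
  Biconnected G S × (∀ T → Biconnected G T → S ⊆ T → T ⊆ S)

IsClique : ∀ {n} → Graph n → VSet n → Set
IsClique G S = ∀ u v → u ∈ S → v ∈ S → u ≢ v → Adj G u v

IsBlockGraph : ∀ {n} → Graph n → Set
IsBlockGraph G = ∀ S → MaximalBiconnected G S → IsClique G S

{-# OPTIONS --safe #-}
-- Switching composes as S(S(G, A), B) = S(G, A ⊕ B), so both lower classes are closed
-- under switching, and it suffices to show that a graph in either lower class already
-- lies in the other graph class.
--
-- C4 and the diamond both contain a 4-cycle 0 1 2 3 without the chord 02.  If such a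
-- pattern is induced in G, switching every vertex with at most one neighbour on it leaves
-- the pattern intact and gives every vertex two neighbours on the cycle.  That graph is
-- biconnected as a whole but not complete, so it is not a block graph.
--
-- Conversely, let S be biconnected and a – b – c an induced path in S.  The vertex before c
-- on a walk from a to c inside S − b is a fourth vertex x, and whatever the adjacencies of x
-- to a, b, c, some switching of these four vertices is a C4 or a diamond.  So a biconnected
-- set is connected without induced P3, hence a clique.
module Submission where

open import Defs hiding (sym)
open import Data.Nat using (ℕ; _+_)
open import Data.Fin using (Fin; _≟_)
open import Data.Fin.Patterns using (0F; 1F; 2F; 3F)
open import Data.Fin.Properties using (any?; all?)
open import Data.Fin.Permutation using (Permutation′; _⟨$⟩ʳ_; transpose)
  renaming (id to idₚ)
open import Data.Bool using (Bool; true; false; not; _∨_; _xor_; if_then_else_)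
open import Data.Bool.Properties
  using (∨-comm; ∨-identityʳ; ∧-zeroʳ; ¬-not; not-¬; xor-assoc; xor-comm; xor-identityʳ; xor-∧-commutativeRing)
  renaming (_≟_ to _≟ᵇ_)
open import Algebra.Bundles using (CommutativeRing)
open import Algebra.Properties.CommutativeSemigroup
  (CommutativeRing.+-commutativeSemigroup xor-∧-commutativeRing) using (interchange)
open import Data.Product using (∃; ∃₂; _×_; _,_)
open import Data.Sum using (_⊎_; inj₁; inj₂; [_,_])
import Data.Sum as Sum
open import Data.Vec using ([]; _∷_; lookup)
open import Data.Vec.Relation.Unary.All using ([]; _∷_)
open import Data.Vec.Relation.Unary.AllPairs using ([]; _∷_)
open import Data.Vec.Relation.Unary.Unique.Propositional using (Unique)
open import Data.Vec.Relation.Unary.Unique.Propositional.Properties using (lookup-injective)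
open import Data.Empty using (⊥; ⊥-elim)
open import Function using (_∘_)
open import Function.Bundles using (_⇔_; mk⇔; Injection)
open import Function.Definitions using (Injective)
open import Function.Properties.Inverse using (↔⇒↣)
open import Relation.Nullary using (¬_; Dec; yes; no; does; ¬?; contradiction)
open import Relation.Nullary.Decidable using (True; toWitness; dec-true; _×-dec_)
open import Relation.Binary.PropositionalEquality
  using (_≡_; _≢_; refl; sym; trans; cong; cong₂; module ≡-Reasoning)

Adj-sym : ∀ {n} (G : Graph n) {u v} → Adj G u v → Adj G v u
Adj-sym G {u} {v} u~v = trans (Graph.sym G v u) u~v

Adj⇒≢ : ∀ {n} (G : Graph n) {u v} → Adj G u v → u ≢ v
Adj⇒≢ G {u} u~u refl = not-¬ u~u (irrefl G u)

full : ∀ {n} → VSet n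
full _ = true

∈-─ : ∀ {n} {S : VSet n} {w y} → y ∈ S → y ≢ w → y ∈ (S ─ w)
∈-─ {w = w} {y} y∈S y≢w with y ≟ w
... | yes y≡w = ⊥-elim (y≢w y≡w)
... | no _ rewrite y∈S = refl

∈-─⇒≢ : ∀ {n} {S : VSet n} {w y} → y ∈ (S ─ w) → y ≢ w
∈-─⇒≢ {S = S} {y = y} y∈S─y refl with y ≟ y
... | yes _ = not-¬ y∈S─y (∧-zeroʳ (S y))
... | no y≢y = y≢y refl

module _ {n} {G : Graph n} {S : VSet n} where

  reach-start : ∀ {u v} → Reach G S u v → u ∈ S
  reach-start (here u∈S)   = u∈S
  reach-start (step r _ _) = reach-start r

  reach-end : ∀ {u v} → Reach G S u v → v ∈ S
  reach-end (here u∈S)     = u∈S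
  reach-end (step _ _ v∈S) = v∈S

  edge : ∀ {u v} → u ∈ S → Adj G u v → v ∈ S → Reach G S u v
  edge u∈S u~v v∈S = step (here u∈S) u~v v∈S

  reach-trans : ∀ {u v w} → Reach G S u v → Reach G S v w → Reach G S u w
  reach-trans r (here _)         = r
  reach-trans r (step r′ e w∈S) = step (reach-trans r r′) e w∈S

  reach-sym : ∀ {u v} → Reach G S u v → Reach G S v u
  reach-sym (here u∈S)          = here u∈S
  reach-sym (step r w~v v∈S) = reach-trans (edge v∈S (Adj-sym G w~v) (reach-end r)) (reach-sym r)

InducedP3Free : ∀ {n} → Graph n → VSet n → Set
InducedP3Free G S = ∀ {a b c} → a ∈ S → b ∈ S → c ∈ S →
  Adj G a b → Adj G b c → a ≢ c → Adj G a c

module _ {n} {G : Graph n} {S : VSet n} (p3Free : InducedP3Free G S) where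

  reach⇒≡⊎Adj : ∀ {u v} → Reach G S u v → u ≡ v ⊎ Adj G u v
  reach⇒≡⊎Adj (here _) = inj₁ refl
  reach⇒≡⊎Adj {u} {v} (step r w~v v∈S) with reach⇒≡⊎Adj r | u ≟ v
  ... | _           | yes u≡v = inj₁ u≡v
  ... | inj₁ refl   | no _    = inj₂ w~v
  ... | inj₂ u~w    | no u≢v  = inj₂ (p3Free (reach-start r) (reach-end r) v∈S u~w w~v u≢v)

  connected-P3Free⇒clique : Connected G S → IsClique G S
  connected-P3Free⇒clique conn u v u∈S v∈S u≢v =
    [ ⊥-elim ∘ u≢v , (λ u~v → u~v) ] (reach⇒≡⊎Adj (conn u v u∈S v∈S))

block-biconnected-full⇒clique : ∀ {n} {G : Graph n} →
  IsBlockGraph G → Biconnected G full → IsClique G full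
block-biconnected-full⇒clique block bic = block full (bic , λ _ _ _ _ _ → refl)

_≗ᴬ_ : ∀ {n} → Graph n → Graph n → Set
G ≗ᴬ H = ∀ u v → adj G u v ≡ adj H u v

AdjInvariant : (∀ {n} → Graph n → Set) → Set
AdjInvariant 𝒢 = ∀ {n} (G H : Graph n) → G ≗ᴬ H → 𝒢 G → 𝒢 H

module _ {n} {G H : Graph n} (G≗H : G ≗ᴬ H) where

  reach-cong : ∀ {S u v} → Reach G S u v → Reach H S u v
  reach-cong (here u∈S)       = here u∈S
  reach-cong (step r e v∈S) = step (reach-cong r) (trans (sym (G≗H _ _)) e) v∈S

  connected-cong : ∀ {S} → Connected G S → Connected H S
  connected-cong conn u v u∈S v∈S = reach-cong (conn u v u∈S v∈S)

  biconnected-cong : ∀ {S} → Biconnected G S → Biconnected H S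
  biconnected-cong (two , conn , cut) =
    two , connected-cong conn , λ v v∈S → connected-cong (cut v v∈S)

  HasInduced-cong : ∀ {k} {P : Fin k → Fin k → Bool} → HasInduced P G → HasInduced P H
  HasInduced-cong (f , f-inj , f-adj) =
    f , f-inj , λ i j → trans (sym (G≗H (f i) (f j))) (f-adj i j)

IsBlockGraph-invariant : AdjInvariant IsBlockGraph
IsBlockGraph-invariant G H G≗H block S (bic , maximal) u v u∈S v∈S u≢v =
  trans (sym (G≗H u v))
    (block S (biconnected-cong H≗G bic , λ T → maximal T ∘ biconnected-cong G≗H) u v u∈S v∈S u≢v)
  where
  H≗G : H ≗ᴬ G
  H≗G u v = sym (G≗H u v)

C4DiamondFree-invariant : AdjInvariant C4DiamondFree
C4DiamondFree-invariant G H G≗H (¬c4 , ¬diamond) =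
  ¬c4 ∘ HasInduced-cong {G = H} {G} H≗G , ¬diamond ∘ HasInduced-cong {G = H} {G} H≗G
  where
  H≗G : H ≗ᴬ G
  H≗G u v = sym (G≗H u v)

_⊕_ : ∀ {n} → VSet n → VSet n → VSet n
(A ⊕ B) v = A v xor B v

switchAdj-xor : ∀ {n} (G : Graph n) (A : VSet n) u v →
  switchAdj G A u v ≡ (A u xor A v) xor adj G u v
switchAdj-xor G A u v with A u | A v
... | true  | true  = refl
... | true  | false = refl
... | false | true  = refl
... | false | false = refl

switch-switch : ∀ {n} (G : Graph n) (A B : VSet n) u v →
  adj (switch (switch G A) B) u v ≡ adj (switch G (A ⊕ B)) u v
switch-switch G A B u v = begin
  switchAdj (switch G A) B u v                       ≡⟨ switchAdj-xor (switch G A) B u v ⟩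
  (B u xor B v) xor switchAdj G A u v                ≡⟨ cong ((B u xor B v) xor_) (switchAdj-xor G A u v) ⟩
  (B u xor B v) xor ((A u xor A v) xor adj G u v)    ≡⟨ sym (xor-assoc (B u xor B v) _ _) ⟩
  ((B u xor B v) xor (A u xor A v)) xor adj G u v    ≡⟨ cong (_xor adj G u v) (xor-comm (B u xor B v) _) ⟩
  ((A u xor A v) xor (B u xor B v)) xor adj G u v    ≡⟨ cong (_xor adj G u v) (interchange (A u) _ _ _) ⟩
  ((A u xor B u) xor (A v xor B v)) xor adj G u v    ≡⟨ sym (switchAdj-xor G (A ⊕ B) u v) ⟩
  switchAdj G (A ⊕ B) u v                            ∎
  where open ≡-Reasoning

LowerSwitching-switch : (𝒢 : ∀ {n} → Graph n → Set) → AdjInvariant 𝒢 →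
  ∀ {n} (G : Graph n) → LowerSwitching 𝒢 G → ∀ A → LowerSwitching 𝒢 (switch G A)
LowerSwitching-switch 𝒢 invariant G lower A B =
  invariant (switch G (A ⊕ B)) (switch (switch G A) B) (λ u v → sym (switch-switch G A B u v)) (lower (A ⊕ B))

HasInduced-trans : ∀ {j k n} {P : Fin j → Fin j → Bool} {Q : Graph k} {G : Graph n} →
  HasInduced P Q → HasInduced (adj Q) G → HasInduced P G
HasInduced-trans (f , f-inj , f-adj) (g , g-inj , g-adj) =
  g ∘ f , f-inj ∘ g-inj , λ i j → trans (g-adj (f i) (f j)) (f-adj i j)

extend : ∀ {k n} → (Fin k → Fin n) → (Fin k → Bool) → VSet n
extend q β v with any? (λ i → q i ≟ v)
... | yes (i , _) = β i
... | no _        = false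

extend-image : ∀ {k n} {q : Fin k → Fin n} → Injective _≡_ _≡_ q → ∀ β i → extend q β (q i) ≡ β i
extend-image {q = q} q-inj β i with any? (λ j → q j ≟ q i)
... | yes (j , qj≡qi) = cong β (q-inj qj≡qi)
... | no none         = ⊥-elim (none (i , refl))

switch-HasInduced : ∀ {k n} {Q : Graph k} {G : Graph n} (β : Fin k → Bool) →
  ((q , _ , _) : HasInduced (adj Q) G) → HasInduced (adj (switch Q β)) (switch G (extend q β))
switch-HasInduced β (q , q-inj , q-adj) = q , q-inj , λ i j →
  cong₂ (λ s g → if s then g else not g)
        (cong₂ sameSide (extend-image q-inj β i) (extend-image q-inj β j))
        (q-adj i j)

HasC4OrDiamond : ∀ {n} → Graph n → Set
HasC4OrDiamond G = HasInduced C4adj G ⊎ HasInduced diamondAdj G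

C4DiamondFree⇒¬HasC4OrDiamond : ∀ {n} {G : Graph n} → C4DiamondFree G → ¬ HasC4OrDiamond G
C4DiamondFree⇒¬HasC4OrDiamond (¬c4 , ¬diamond) = [ ¬c4 , ¬diamond ]

HasC4OrDiamond-trans : ∀ {k n} {Q : Graph k} {G : Graph n} →
  HasC4OrDiamond Q → HasInduced (adj Q) G → HasC4OrDiamond G
HasC4OrDiamond-trans {Q = Q} {G} c4⊎diamond Q⊑G =
  Sum.map (HasInduced-trans′ C4adj) (HasInduced-trans′ diamondAdj) c4⊎diamond
  where
  HasInduced-trans′ : ∀ P → HasInduced P Q → HasInduced P G
  HasInduced-trans′ P P⊑Q = HasInduced-trans {P = P} {Q} {G} P⊑Q Q⊑G

TwoTrue : ∀ {k} → (Fin k → Bool) → Set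
TwoTrue b = ∃₂ λ i j → i ≢ j × b i ≡ true × b j ≡ true

twoTrue? : ∀ {k} (b : Fin k → Bool) → Dec (TwoTrue b)
twoTrue? b = any? λ i → any? λ j → ¬? (i ≟ j) ×-dec b i ≟ᵇ true ×-dec b j ≟ᵇ true

TwoTrue-cong : ∀ {k} {b b′ : Fin k → Bool} → (∀ i → b i ≡ b′ i) → TwoTrue b → TwoTrue b′
TwoTrue-cong b≗b′ (i , j , i≢j , bi , bj) = i , j , i≢j , trans (sym (b≗b′ i)) bi , trans (sym (b≗b′ j)) bj

repeatedValue : ∀ {k} (b : Fin (3 + k) → Bool) → ∃₂ λ i j → i ≢ j × b i ≡ b j
repeatedValue b with b 0F ≟ᵇ b 1F | b 0F ≟ᵇ b 2F
... | yes b₀≡b₁ | _         = 0F , 1F , (λ ()) , b₀≡b₁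
... | no _      | yes b₀≡b₂ = 0F , 2F , (λ ()) , b₀≡b₂
... | no b₀≢b₁  | no b₀≢b₂  = 1F , 2F , (λ ()) , trans (¬-not (b₀≢b₁ ∘ sym)) (sym (¬-not (b₀≢b₂ ∘ sym)))

¬TwoTrue⇒TwoTrue-not : ∀ {k} (b : Fin (3 + k) → Bool) → ¬ TwoTrue b → TwoTrue (not ∘ b)
¬TwoTrue⇒TwoTrue-not b ¬two with repeatedValue b
... | i , j , i≢j , bi≡bj with b i in bi
...   | true  = ⊥-elim (¬two (i , j , i≢j , bi , sym bi≡bj))
...   | false = i , j , i≢j , cong not bi , cong not (sym bi≡bj)

TwoTrue-flip : ∀ {k} (b : Fin (3 + k) → Bool) (two? : Dec (TwoTrue b)) →
  TwoTrue (λ i → not (does two?) xor b i)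
TwoTrue-flip b (yes two)  = two
TwoTrue-flip b (no ¬two) = ¬TwoTrue⇒TwoTrue-not b ¬two

-- Biconnectivity from a dominating 4-cycle

module TwoNeighboursOnCycle {n} (G : Graph n) (f : Fin 4 → Fin n) (f-inj : Injective _≡_ _≡_ f)
  (e₀₁ : Adj G (f 0F) (f 1F)) (e₁₂ : Adj G (f 1F) (f 2F))
  (e₂₃ : Adj G (f 2F) (f 3F)) (e₃₀ : Adj G (f 3F) (f 0F))
  (twoNeighbours : ∀ y → TwoTrue (λ k → adj G y (f k))) where

  module Avoiding (w : Fin n) {S : VSet n} (inS : ∀ {y} → y ≢ w → y ∈ S) where

    avoid : ∀ {i j} → f i ≡ w → i ≢ j → f j ≢ w
    avoid fi≡w i≢j fj≡w = i≢j (f-inj (trans fi≡w (sym fj≡w)))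

    toF₀ : f 0F ≢ w → ∀ k → f k ≢ w → Reach G S (f k) (f 0F)
    toF₀ f₀≢w 0F _   = here (inS f₀≢w)
    toF₀ f₀≢w 1F f₁≢w = edge (inS f₁≢w) (Adj-sym G e₀₁) (inS f₀≢w)
    toF₀ f₀≢w 3F f₃≢w = edge (inS f₃≢w) e₃₀ (inS f₀≢w)
    toF₀ f₀≢w 2F f₂≢w with f 1F ≟ w
    ... | no f₁≢w  = reach-trans (edge (inS f₂≢w) (Adj-sym G e₁₂) (inS f₁≢w)) (toF₀ f₀≢w 1F f₁≢w)
    ... | yes f₁≡w = reach-trans (edge (inS f₂≢w) e₂₃ (inS f₃≢w)) (toF₀ f₀≢w 3F f₃≢w)
      where f₃≢w = avoid f₁≡w (λ ())

    toF₂ : f 0F ≡ w → ∀ k → f k ≢ w → Reach G S (f k) (f 2F)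
    toF₂ f₀≡w 0F f₀≢w = ⊥-elim (f₀≢w f₀≡w)
    toF₂ f₀≡w 1F f₁≢w = edge (inS f₁≢w) e₁₂ (inS (avoid f₀≡w λ ()))
    toF₂ f₀≡w 2F f₂≢w = here (inS f₂≢w)
    toF₂ f₀≡w 3F f₃≢w = edge (inS f₃≢w) (Adj-sym G e₂₃) (inS (avoid f₀≡w λ ()))

    hub : ∃ λ h → ∀ k → f k ≢ w → Reach G S (f k) h
    hub with f 0F ≟ w
    ... | no f₀≢w  = f 0F , toF₀ f₀≢w
    ... | yes f₀≡w = f 2F , toF₂ f₀≡w

    toCycle : ∀ {u} → u ∈ S → ∃ λ k → f k ≢ w × Reach G S u (f k)
    toCycle {u} u∈S with twoNeighbours u
    ... | i , j , i≢j , u~fi , u~fj with f i ≟ w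
    ...   | no fi≢w  = i , fi≢w , edge u∈S u~fi (inS fi≢w)
    ...   | yes fi≡w = j , fj≢w , edge u∈S u~fj (inS fj≢w)
      where fj≢w = avoid fi≡w i≢j

    connected : Connected G S
    connected u v u∈S v∈S with hub | toCycle u∈S | toCycle v∈S
    ... | _ , toHub | k , fk≢w , u⇝fk | l , fl≢w , v⇝fl =
      reach-trans (reach-trans u⇝fk (toHub k fk≢w)) (reach-sym (reach-trans v⇝fl (toHub l fl≢w)))

  biconnected : Biconnected G full
  biconnected = (f 0F , f 1F , (λ f₀≡f₁ → contradiction (f-inj f₀≡f₁) λ ()) , refl , refl)
              , Avoiding.connected (f 0F) (λ _ → refl)
              , λ w _ → Avoiding.connected w (∈-─ refl)

  ¬block : adj G (f 0F) (f 2F) ≡ false → ¬ IsBlockGraph G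
  ¬block f₀≁f₂ block = not-¬ f₀~f₂ f₀≁f₂
    where
    f₀~f₂ : Adj G (f 0F) (f 2F)
    f₀~f₂ = block-biconnected-full⇒clique block biconnected (f 0F) (f 2F) refl refl
              (λ f₀≡f₂ → contradiction (f-inj f₀≡f₂) λ ())

record CyclicPattern (P : Fin 4 → Fin 4 → Bool) : Set where
  field
    cycle₀₁       : P 0F 1F ≡ true
    cycle₁₂       : P 1F 2F ≡ true
    cycle₂₃       : P 2F 3F ≡ true
    cycle₃₀       : P 3F 0F ≡ true
    chord         : P 0F 2F ≡ false
    twoNeighbours : ∀ i → TwoTrue (P i)

C4-cyclic : CyclicPattern C4adj
C4-cyclic = record
  { cycle₀₁       = refl
  ; cycle₁₂       = refl
  ; cycle₂₃       = refl
  ; cycle₃₀       = refl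
  ; chord         = refl
  ; twoNeighbours = toWitness {a? = all? λ i → twoTrue? (C4adj i)} _
  }

diamond-cyclic : CyclicPattern diamondAdj
diamond-cyclic = record
  { cycle₀₁       = refl
  ; cycle₁₂       = refl
  ; cycle₂₃       = refl
  ; cycle₃₀       = refl
  ; chord         = refl
  ; twoNeighbours = toWitness {a? = all? λ i → twoTrue? (diamondAdj i)} _
  }

module SwitchLonely {n} (H : Graph n) {P : Fin 4 → Fin 4 → Bool} (cyclic : CyclicPattern P)
  (f : Fin 4 → Fin n) (f-inj : Injective _≡_ _≡_ f) (f-adj : ∀ i j → adj H (f i) (f j) ≡ P i j) where
  open CyclicPattern cyclic

  lonely : VSet n
  lonely y = not (does (twoTrue? (λ k → adj H y (f k))))

  lonely-pattern : ∀ k → lonely (f k) ≡ false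
  lonely-pattern k = cong not (dec-true (twoTrue? _) (TwoTrue-cong (λ i → sym (f-adj k i)) (twoNeighbours k)))

  H′ : Graph n
  H′ = switch H lonely

  H′-pattern : ∀ i j → adj H′ (f i) (f j) ≡ P i j
  H′-pattern i j = trans
    (cong₂ (λ s t → if sameSide s t then adj H (f i) (f j) else not (adj H (f i) (f j)))
           (lonely-pattern i) (lonely-pattern j))
    (f-adj i j)

  H′-twoNeighbours : ∀ y → TwoTrue (λ k → adj H′ y (f k))
  H′-twoNeighbours y = TwoTrue-cong flipped (TwoTrue-flip (λ k → adj H y (f k)) (twoTrue? _))
    where
    open ≡-Reasoning
    flipped : ∀ k → lonely y xor adj H y (f k) ≡ adj H′ y (f k)
    flipped k = begin
      lonely y xor adj H y (f k)                      ≡⟨ cong (_xor adj H y (f k)) (sym (xor-identityʳ (lonely y))) ⟩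
      (lonely y xor false) xor adj H y (f k)          ≡⟨ cong (λ z → (lonely y xor z) xor adj H y (f k)) (sym (lonely-pattern k)) ⟩
      (lonely y xor lonely (f k)) xor adj H y (f k)   ≡⟨ sym (switchAdj-xor H lonely y (f k)) ⟩
      adj H′ y (f k)                                  ∎

  ¬lowerBlock : ¬ LowerSwitching IsBlockGraph H
  ¬lowerBlock lowerBlock =
    TwoNeighboursOnCycle.¬block H′ f f-inj (edgeOf cycle₀₁) (edgeOf cycle₁₂) (edgeOf cycle₂₃) (edgeOf cycle₃₀)
      H′-twoNeighbours (trans (H′-pattern 0F 2F) chord) (lowerBlock lonely)
    where
    edgeOf : ∀ {i j} → P i j ≡ true → Adj H′ (f i) (f j)
    edgeOf {i} {j} Pij = trans (H′-pattern i j) Pij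

lowerBlock⇒¬HasInduced : ∀ {n} (H : Graph n) {P} → CyclicPattern P →
  LowerSwitching IsBlockGraph H → ¬ HasInduced P H
lowerBlock⇒¬HasInduced H cyclic lowerBlock (f , f-inj , f-adj) =
  SwitchLonely.¬lowerBlock H cyclic f f-inj f-adj lowerBlock

-- Switching classes on four vertices

undirected : ∀ {n} (e : Fin n → Fin n → Bool) → (∀ i → e i i ≡ false) → Graph n
undirected e loopless = record
  { adj    = λ i j → e i j ∨ e j i
  ; sym    = λ i j → ∨-comm (e i j) (e j i)
  ; irrefl = λ i → cong₂ _∨_ (loopless i) (loopless i)
  }

pathPlus : Bool → Bool → Bool → Graph 4
pathPlus a₃ b₃ c₃ = undirected arcs λ { 0F → refl ; 1F → refl ; 2F → refl ; 3F → refl }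
  where
  arcs : Fin 4 → Fin 4 → Bool
  arcs 0F 1F = true
  arcs 1F 2F = true
  arcs 0F 3F = a₃
  arcs 1F 3F = b₃
  arcs 2F 3F = c₃
  arcs _  _  = false

data SwitchesToC4OrDiamond {n} (Q : Graph n) : Set where
  switchTo : (β : VSet n) → HasC4OrDiamond (switch Q β) → SwitchesToC4OrDiamond Q

matches? : (Q : Graph 4) (π : Permutation′ 4) (P : Fin 4 → Fin 4 → Bool) →
  Dec (∀ i j → adj Q (π ⟨$⟩ʳ i) (π ⟨$⟩ʳ j) ≡ P i j)
matches? Q π P = all? λ i → all? λ j → adj Q (π ⟨$⟩ʳ i) (π ⟨$⟩ʳ j) ≟ᵇ P i j

inducedVia : ∀ {P} (Q : Graph 4) (π : Permutation′ 4) → True (matches? Q π P) → HasInduced P Q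
inducedVia Q π check = (π ⟨$⟩ʳ_) , Injection.injective (↔⇒↣ π) , toWitness check

c4Via : ∀ {Q : Graph 4} (β : VSet 4) (π : Permutation′ 4) →
  True (matches? (switch Q β) π C4adj) → SwitchesToC4OrDiamond Q
c4Via {Q} β π check = switchTo β (inj₁ (inducedVia (switch Q β) π check))

diamondVia : ∀ {Q : Graph 4} (β : VSet 4) (π : Permutation′ 4) →
  True (matches? (switch Q β) π diamondAdj) → SwitchesToC4OrDiamond Q
diamondVia {Q} β π check = switchTo β (inj₂ (inducedVia (switch Q β) π check))

pathPlus-switch : ∀ a₃ b₃ c₃ → SwitchesToC4OrDiamond (pathPlus a₃ b₃ c₃)
pathPlus-switch true  false true  = c4Via      (λ _ → false)                             idₚ _
pathPlus-switch false true  false = c4Via      (λ { 3F → true ; _ → false })             idₚ _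
pathPlus-switch true  true  true  = diamondVia (λ _ → false)                             idₚ _
pathPlus-switch false false false = diamondVia (λ { 3F → true ; _ → false })             idₚ _
pathPlus-switch true  true  false = diamondVia (λ { 2F → true ; _ → false })             (transpose 0F 1F) _
pathPlus-switch false false true  = diamondVia (λ { 2F → true ; 3F → true ; _ → false }) (transpose 0F 1F) _
pathPlus-switch false true  true  = diamondVia (λ { 0F → true ; _ → false })             (transpose 1F 2F) _
pathPlus-switch true  false false = diamondVia (λ { 0F → true ; 3F → true ; _ → false }) (transpose 1F 2F) _

module _ {n} (H : Graph n) (lowerFree : LowerSwitching C4DiamondFree H) where

  noInducedPathPlus : ∀ {a b c x} → Adj H a b → Adj H b c → adj H a c ≡ false → a ≢ c →
    x ≢ a → x ≢ b → x ≢ c → ⊥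
  noInducedPathPlus {a} {b} {c} {x} a~b b~c a≁c a≢c x≢a x≢b x≢c
    with switchTo β c4⊎diamond ← pathPlus-switch (adj H a x) (adj H b x) (adj H c x) =
    C4DiamondFree⇒¬HasC4OrDiamond {G = Hβ} (lowerFree (extend q β))
      (HasC4OrDiamond-trans {Q = switch Q β} {Hβ} c4⊎diamond (switch-HasInduced {Q = Q} {H} β Q⊑H))
    where
    Q : Graph 4
    Q = pathPlus (adj H a x) (adj H b x) (adj H c x)

    q : Fin 4 → Fin n
    q = lookup (a ∷ b ∷ c ∷ x ∷ [])

    distinct : Unique (a ∷ b ∷ c ∷ x ∷ [])
    distinct = (Adj⇒≢ H a~b ∷ a≢c ∷ x≢a ∘ sym ∷ [])
             ∷ (Adj⇒≢ H b~c ∷ x≢b ∘ sym ∷ [])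
             ∷ (x≢c ∘ sym ∷ [])
             ∷ []
             ∷ []

    q-adj : ∀ i j → adj H (q i) (q j) ≡ adj Q i j
    q-adj 0F 0F = irrefl H a
    q-adj 0F 1F = a~b
    q-adj 0F 2F = a≁c
    q-adj 0F 3F = sym (∨-identityʳ _)
    q-adj 1F 0F = Adj-sym H a~b
    q-adj 1F 1F = irrefl H b
    q-adj 1F 2F = b~c
    q-adj 1F 3F = sym (∨-identityʳ _)
    q-adj 2F 0F = trans (Graph.sym H c a) a≁c
    q-adj 2F 1F = Adj-sym H b~c
    q-adj 2F 2F = irrefl H c
    q-adj 2F 3F = sym (∨-identityʳ _)
    q-adj 3F 0F = Graph.sym H x a
    q-adj 3F 1F = Graph.sym H x b
    q-adj 3F 2F = Graph.sym H x c
    q-adj 3F 3F = irrefl H x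

    Q⊑H : HasInduced (adj Q) H
    Q⊑H = q , (λ {i} {j} → lookup-injective distinct i j) , q-adj

    Hβ : Graph n
    Hβ = switch H (extend q β)

  biconnected⇒P3Free : ∀ {S} → Biconnected H S → InducedP3Free H S
  biconnected⇒P3Free {S} (_ , _ , cut) {a} {b} {c} a∈S b∈S c∈S a~b b~c a≢c with adj H a c in a≁c
  ... | true  = refl
  ... | false with cut b b∈S a c (∈-─ {S = S} a∈S (Adj⇒≢ H a~b)) (∈-─ {S = S} c∈S (Adj⇒≢ H b~c ∘ sym))
  ...   | here _ = ⊥-elim (a≢c refl)
  ...   | step {w} a⇝w w~c _ =
    ⊥-elim (noInducedPathPlus a~b b~c a≁c a≢c w≢a (∈-─⇒≢ {S = S} (reach-end a⇝w)) (Adj⇒≢ H w~c))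
    where
    w≢a : w ≢ a
    w≢a refl = not-¬ w~c a≁c

  lowerFree⇒block : IsBlockGraph H
  lowerFree⇒block S (bic@(_ , conn , _) , _) = connected-P3Free⇒clique (biconnected⇒P3Free bic) conn

mainTheorem14 : (n : ℕ) (G : Graph n) →
    LowerSwitching IsBlockGraph G ⇔ LowerSwitching C4DiamondFree G
mainTheorem14 n G = mk⇔ lowerBlock⇒lowerFree lowerFree⇒lowerBlock
  where
  lowerBlock⇒lowerFree : LowerSwitching IsBlockGraph G → LowerSwitching C4DiamondFree G
  lowerBlock⇒lowerFree lowerBlock A =
    lowerBlock⇒¬HasInduced (switch G A) C4-cyclic lowerBlockᴬ ,
    lowerBlock⇒¬HasInduced (switch G A) diamond-cyclic lowerBlockᴬ
    where
    lowerBlockᴬ : LowerSwitching IsBlockGraph (switch G A)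
    lowerBlockᴬ = LowerSwitching-switch IsBlockGraph IsBlockGraph-invariant G lowerBlock A

  lowerFree⇒lowerBlock : LowerSwitching C4DiamondFree G → LowerSwitching IsBlockGraph G
  lowerFree⇒lowerBlock lowerFree A =
    lowerFree⇒block (switch G A) (LowerSwitching-switch C4DiamondFree C4DiamondFree-invariant G lowerFree A)
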